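{- Fix a positive integer $k$. $\tilde S_A$ and $\tilde S_B$ correspond to the sets of deterministic $k$-bit communication strategies of Alice and Bob respectively, in the following sense. For every deterministic strategy $f_A$ of Alice there exist vectors $\tilde x_A\in\tilde S_A$ and $x_A\in S_A$, and for every deterministic strategy $f_B$ of Bob there exist vectors $\tilde x_B\in\tilde S_B$ and $x_B\in S_B$, such that if $\ell\in\{0,1\}^k$ is the transcript of the interaction between Alice and Bob under $f_A$ and $f_B$, then $\ell$ is the unique sequence satisfying $\tilde x_A(\ell)=\tilde x_B(\ell)=1$, and $\langle x_A,x_B\rangle=1$ if the interaction accepts and $\langle x_A,x_B\rangle=0$ otherwise. Conversely, every vector $x_A\in S_A$ corresponds to a deterministic strategy $f_A$ for Alice (and similarly every $x_B\in S_B$ to a strategy $f_B$ for Bob) such that Alice and Bob accept the interaction iff $\langle x_A,x_B\rangle=1$.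
   Context: Canonical $k$-bit protocols: Alice and Bob alternate sending one bit per round for $k$ rounds, Alice sending bits $\ell_1,\ell_3,\dots$ (odd positions) and Bob bits $\ell_2,\ell_4,\dots$ (even positions); the transcript is $\ell=(\ell_1,\dots,\ell_k)\in\{0,1\}^k$ and the interaction accepts iff $\ell_k=1$ (verdict $v(\ell)=\ell_k$). A deterministic strategy of Alice is a family of functions $f_A^{j}:\{0,1\}^{j}\to\{0,1\}$ for even $j$ with $0\le j<k$, with $\ell_{j+1}=f_A^{j}(\ell_1,\dots,\ell_j)$; a deterministic strategy of Bob is a family $f_B^{j}:\{0,1\}^j\to\{0,1\}$ for odd $j<k$, with $\ell_{j+1}=f_B^j(\ell_1,\dots,\ell_j)$. Vectors $x\in[0,1]^{2^k}$ are indexed by $\{0,1\}^k$. For such $x$ define for $0\le j\le k$ and $i_1,\dots,i_j\in\{0,1\}$: $\hat x_A(i_1,\dots,i_k)=\hat x_B(i_1,\dots,i_k)=x(i_1,\dots,i_k)$; for $j<k$: $\hat x_A(i_1,\dots,i_j)=\hat x_A(i_1,\dots,i_j,0)+\hat x_A(i_1,\dots,i_j,1)$ if $j$ is even and $=\frac12(\hat x_A(i_1,\dots,i_j,0)+\hat x_A(i_1,\dots,i_j,1))$ if $j$ is odd; and $\hat x_B(i_1,\dots,i_j)=\frac12(\hat x_B(\dots,0)+\hat x_B(\dots,1))$ if $j$ is even and $=\hat x_B(\dots,0)+\hat x_B(\dots,1)$ if $j$ is odd. Let $\tilde K_A=\{x\in[0,1]^{2^k}:\hat x_A()=1$ and for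 all odd $j<k$ and all $i_1,\dots,i_j$, $\hat x_A(i_1,\dots,i_j,0)=\hat x_A(i_1,\dots,i_j,1)\}$ and $\tilde K_B=\{x\in[0,1]^{2^k}:\hat x_B()=1$ and for all even $j<k$ and all $i_1,\dots,i_j$, $\hat x_B(i_1,\dots,i_j,0)=\hat x_B(i_1,\dots,i_j,1)\}$. Let $v\in\{0,1\}^{2^k}$, $v(i_1,\dots,i_k)=i_k$, let $\ast$ be coordinatewise product, $K_A=\{x\ast v:x\in\tilde K_A\}$, $K_B=\{x\ast v:x\in\tilde K_B\}$, and $\tilde S_A=\tilde K_A\cap\{0,1\}^{2^k}$, $\tilde S_B=\tilde K_B\cap\{0,1\}^{2^k}$, $S_A=K_A\cap\{0,1\}^{2^k}$, $S_B=K_B\cap\{0,1\}^{2^k}$. $\langle\cdot,\cdot\rangle$ is the standard inner product on $\mathbb R^{2^k}$.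
   Formalization: Vectors indexed by $\{0,1\}^k$, including the elements of $\tilde K_A$, $\tilde K_B$ and the witnesses whose products with $v$ form $K_A$ and $K_B$, have rational rather than real coordinates. -}

module Defs where

open import Data.Bool using (Bool; true; false; if_then_else_; not)
open import Data.Nat using (ℕ; zero; suc)
open import Data.Vec using (Vec; []; _∷_; _∷ʳ_)
open import Data.Rational using (ℚ; 0ℚ; 1ℚ; ½; _+_; _*_; _≤_)
open import Data.Product using (Σ; _×_; _,_)
open import Data.Sum using (_⊎_)
open import Data.Unit using (⊤)
open import Relation.Binary.PropositionalEquality using (_≡_)

-- Index set {0,1}^k is Vec Bool k (false = 0, true = 1); a vector in
-- ℚ^{2^k} is a function Vec Bool k → ℚ.  Values lie in [0,1] ∩ ℚ, which
-- suffices: all the sets S̃_A, S_A, ... consist of 0/1 vectors, and the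
-- witnesses y of x = y ∗ v are only required to exist.
Vect : ℕ → Set
Vect k = Vec Bool k → ℚ

isEven : ℕ → Bool
isEven zero    = true
isEven (suc j) = not (isEven j)

child : ∀ {m} → Bool → Vect (suc m) → Vect m
child b x s = x (b ∷ s)

-- hatA d m x = x̂_A(i_1,…,i_d), where x : Vect m is the restriction
-- s ↦ x(i_1,…,i_d,s) of the original vector to the prefix (i_1,…,i_d)
-- (so d is the prefix length j of the paper and k = d + m).
hatA : (d m : ℕ) → Vect m → ℚ
hatA d zero    x = x []
hatA d (suc m) x =
  if isEven d
  then hatA (suc d) m (child false x) + hatA (suc d) m (child true x)
  else ½ * (hatA (suc d) m (child false x) + hatA (suc d) m (child true x))

hatB : (d m : ℕ) → Vect m → ℚ
hatB d zero    x = x []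
hatB d (suc m) x =
  if isEven d
  then ½ * (hatB (suc d) m (child false x) + hatB (suc d) m (child true x))
  else hatB (suc d) m (child false x) + hatB (suc d) m (child true x)

-- ConsA d m x : for every prefix p of length j ≥ d below the current node
-- with j odd and j < k, x̂_A(p,0) = x̂_A(p,1).
ConsA : (d m : ℕ) → Vect m → Set
ConsA d zero    x = ⊤
ConsA d (suc m) x =
  (if isEven d then ⊤
   else hatA (suc d) m (child false x) ≡ hatA (suc d) m (child true x))
  × ConsA (suc d) m (child false x) × ConsA (suc d) m (child true x)

-- the same for B with even j < k
ConsB : (d m : ℕ) → Vect m → Set
ConsB d zero    x = ⊤
ConsB d (suc m) x =
  (if isEven d
   then hatB (suc d) m (child false x) ≡ hatB (suc d) m (child true x)
   else ⊤)
  × ConsB (suc d) m (child false x) × ConsB (suc d) m (child true x)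

UnitCube : ∀ {k} → Vect k → Set
UnitCube x = ∀ ℓ → 0ℚ ≤ x ℓ × x ℓ ≤ 1ℚ

Binary : ∀ {k} → Vect k → Set
Binary x = ∀ ℓ → x ℓ ≡ 0ℚ ⊎ x ℓ ≡ 1ℚ

K̃A : (k : ℕ) → Vect k → Set
K̃A k x = UnitCube x × hatA 0 k x ≡ 1ℚ × ConsA 0 k x

K̃B : (k : ℕ) → Vect k → Set
K̃B k x = UnitCube x × hatB 0 k x ≡ 1ℚ × ConsB 0 k x

-- verdict v(ℓ) = ℓ_k (last bit); the value on the empty transcript is
-- irrelevant (k ≥ 1 throughout).
verdict : ∀ {k} → Vec Bool k → Bool
verdict []          = false
verdict (b ∷ [])    = b
verdict (_ ∷ c ∷ r) = verdict (c ∷ r)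

boolℚ : Bool → ℚ
boolℚ true  = 1ℚ
boolℚ false = 0ℚ

vVec : ∀ {k} → Vect k
vVec ℓ = boolℚ (verdict ℓ)

KA : (k : ℕ) → Vect k → Set
KA k x = Σ (Vect k) λ y → K̃A k y × (∀ ℓ → x ℓ ≡ y ℓ * vVec ℓ)

KB : (k : ℕ) → Vect k → Set
KB k x = Σ (Vect k) λ y → K̃B k y × (∀ ℓ → x ℓ ≡ y ℓ * vVec ℓ)

S̃A S̃B SA SB : (k : ℕ) → Vect k → Set
S̃A k x = K̃A k x × Binary x
S̃B k x = K̃B k x × Binary x
SA k x = KA k x × Binary x
SB k x = KB k x × Binary x

⟨_,_⟩ : ∀ {k} → Vect k → Vect k → ℚ
⟨_,_⟩ {zero}  x y = x [] * y []
⟨_,_⟩ {suc k} x y = ⟨ child false x , child false y ⟩ + ⟨ child true x , child true y ⟩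

-- Deterministic strategies: f j : {0,1}^j → {0,1}.  For Alice only the
-- values at even j < k are used, for Bob only those at odd j < k.
Strategy : Set
Strategy = (j : ℕ) → Vec Bool j → Bool

-- run d m p : the remaining m bits of the transcript, given that the
-- first d bits are p.  Bit ℓ_{d+1} is sent by Alice iff d+1 is odd.
run : Strategy → Strategy → (d m : ℕ) → Vec Bool d → Vec Bool m
run fA fB d zero    p = []
run fA fB d (suc m) p =
  let b = if isEven d then fA d p else fB d p
  in b ∷ run fA fB (suc d) m (p ∷ʳ b)

transcript : (k : ℕ) → Strategy → Strategy → Vec Bool k
transcript k fA fB = run fA fB 0 k []

-- A strategy is represented by the indicator of the transcripts that follow it (x̃), masked by v (x).
-- The sets of transcripts following Alice's and Bob's strategies meet exactly in the transcript of
-- their play, so the masked inner product is the verdict. Conversely, a 0/1 vector x ∈ S_A induces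
-- the strategy "send 1 iff some leaf below the 1-move carries x = 1", and x is exactly the masked
-- indicator of that strategy: a leaf with x = 1 follows it, since leaves with x = 1 below both moves
-- of Alice would force x̂_A ≥ 2; and a followed accepting leaf carries x = 1, either directly (Alice
-- moves last) or because the weight x̂_A = 1 is passed along every followed path (Bob moves last).
module Submission where

open import Defs
open import Data.Bool using (Bool; true; false; if_then_else_; not; _∧_; _∨_)
import Data.Bool as Bool
open import Data.Bool.Properties using (∧-conicalˡ; ∧-conicalʳ; ∨-conicalˡ; ∨-conicalʳ; ∨-zeroʳ; ∧-idem; ¬-not)
open import Data.Nat using (ℕ; zero; suc; _<_)
open import Data.Vec using (Vec; []; _∷_; _∷ʳ_)
open import Data.Vec.Properties using (∷-injectiveʳ)
open import Data.Rational using (ℚ; 0ℚ; 1ℚ; ½; _+_; _*_; _≤_; _≟_; _≤?_)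
import Data.Rational.Properties as ℚ
open import Data.Product using (Σ; _×_; _,_; proj₁; proj₂)
open import Data.Sum using (inj₁; inj₂)
open import Data.Unit using (⊤; tt)
open import Data.Empty using (⊥; ⊥-elim)
open import Function using (id; _∘_)
open import Function.Bundles using (_⇔_; mk⇔)
open import Relation.Nullary using (Dec; yes; does)
open import Relation.Nullary.Decidable using (dec-true; from-yes; from-no)
open import Relation.Binary.PropositionalEquality

fromDoes : ∀ {A : Set} (a? : Dec A) → does a? ≡ true → A
fromDoes (yes a) _ = a

indicator : ∀ {k} → (Vec Bool k → Bool) → Vect k
indicator a ℓ = boolℚ (a ℓ)

boolℚ-* : ∀ a b → boolℚ a * boolℚ b ≡ boolℚ (a ∧ b)
boolℚ-* true  true  = refl
boolℚ-* true  false = refl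
boolℚ-* false true  = refl
boolℚ-* false false = refl

boolℚ≡1⇒true : ∀ {b} → boolℚ b ≡ 1ℚ → b ≡ true
boolℚ≡1⇒true {true}  _ = refl
boolℚ≡1⇒true {false} ()

indicator-unitCube : ∀ {k} (a : Vec Bool k → Bool) → UnitCube (indicator a)
indicator-unitCube a ℓ with a ℓ
... | true  = from-yes (0ℚ ≤? 1ℚ) , ℚ.≤-refl
... | false = ℚ.≤-refl , from-yes (0ℚ ≤? 1ℚ)

indicator-binary : ∀ {k} (a : Vec Bool k → Bool) → Binary (indicator a)
indicator-binary a ℓ with a ℓ
... | true  = inj₂ refl
... | false = inj₁ refl

⟨⟩-cong : ∀ {k} {x x′ y y′ : Vect k} → (∀ ℓ → x ℓ ≡ x′ ℓ) → (∀ ℓ → y ℓ ≡ y′ ℓ) →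
  ⟨ x , y ⟩ ≡ ⟨ x′ , y′ ⟩
⟨⟩-cong {zero}  p q = cong₂ _*_ (p []) (q [])
⟨⟩-cong {suc k} p q =
  cong₂ _+_ (⟨⟩-cong (p ∘ (false ∷_)) (q ∘ (false ∷_))) (⟨⟩-cong (p ∘ (true ∷_)) (q ∘ (true ∷_)))

⟨indicator⟩-disjoint : ∀ {k} (a b : Vec Bool k → Bool) → (∀ ℓ → a ℓ ∧ b ℓ ≡ false) →
  ⟨ indicator a , indicator b ⟩ ≡ 0ℚ
⟨indicator⟩-disjoint {zero}  a b d = trans (boolℚ-* (a []) (b [])) (cong boolℚ (d []))
⟨indicator⟩-disjoint {suc k} a b d =
  cong₂ _+_ (⟨indicator⟩-disjoint (a ∘ (false ∷_)) (b ∘ (false ∷_)) (d ∘ (false ∷_)))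
            (⟨indicator⟩-disjoint (a ∘ (true ∷_)) (b ∘ (true ∷_)) (d ∘ (true ∷_)))

⟨indicator⟩-single : ∀ {k} (a b : Vec Bool k → Bool) t → (∀ ℓ → a ℓ ∧ b ℓ ≡ true → ℓ ≡ t) →
  ⟨ indicator a , indicator b ⟩ ≡ boolℚ (a t ∧ b t)
⟨indicator⟩-single {zero} a b [] _ = boolℚ-* (a []) (b [])
⟨indicator⟩-single {suc k} a b (false ∷ t) u =
  trans (cong₂ _+_ (⟨indicator⟩-single (a ∘ (false ∷_)) (b ∘ (false ∷_)) t (λ s → ∷-injectiveʳ ∘ u (false ∷ s)))
                   (⟨indicator⟩-disjoint (a ∘ (true ∷_)) (b ∘ (true ∷_)) (λ s → ¬-not (case ∘ u (true ∷ s)))))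
        (ℚ.+-identityʳ _)
  where case : ∀ {s} → true ∷ s ≢ false ∷ t
        case ()
⟨indicator⟩-single {suc k} a b (true ∷ t) u =
  trans (cong₂ _+_ (⟨indicator⟩-disjoint (a ∘ (false ∷_)) (b ∘ (false ∷_)) (λ s → ¬-not (case ∘ u (false ∷ s))))
                   (⟨indicator⟩-single (a ∘ (true ∷_)) (b ∘ (true ∷_)) t (λ s → ∷-injectiveʳ ∘ u (true ∷ s))))
        (ℚ.+-identityˡ _)
  where case : ∀ {s} → false ∷ s ≢ true ∷ t
        case ()

-- In hat e, the top layer sums when e (the owner of the hat moves there) and averages otherwise;
-- x̂_A is hat true and x̂_B is hat false at the root.
hat : Bool → (m : ℕ) → Vect m → ℚ
hat e zero    x = x []
hat e (suc m) x =
  if e then hat (not e) m (child false x) + hat (not e) m (child true x)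
  else ½ * (hat (not e) m (child false x) + hat (not e) m (child true x))

Consistent : Bool → (m : ℕ) → Vect m → Set
Consistent e zero    x = ⊤
Consistent e (suc m) x =
  (if e then ⊤ else hat (not e) m (child false x) ≡ hat (not e) m (child true x))
  × Consistent (not e) m (child false x) × Consistent (not e) m (child true x)

hatA≡hat : ∀ d m x → hatA d m x ≡ hat (isEven d) m x
hatA≡hat d zero    x = refl
hatA≡hat d (suc m) x
  rewrite hatA≡hat (suc d) m (child false x) | hatA≡hat (suc d) m (child true x) = refl

hatB≡hat : ∀ d m x → hatB d m x ≡ hat (not (isEven d)) m x
hatB≡hat d zero    x = refl
hatB≡hat d (suc m) x
  rewrite hatB≡hat (suc d) m (child false x) | hatB≡hat (suc d) m (child true x)
  with isEven d
... | true  = refl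
... | false = refl

ConsA≡Consistent : ∀ d m x → ConsA d m x ≡ Consistent (isEven d) m x
ConsA≡Consistent d zero    x = refl
ConsA≡Consistent d (suc m) x
  rewrite hatA≡hat (suc d) m (child false x) | hatA≡hat (suc d) m (child true x)
        | ConsA≡Consistent (suc d) m (child false x) | ConsA≡Consistent (suc d) m (child true x) = refl

ConsB≡Consistent : ∀ d m x → ConsB d m x ≡ Consistent (not (isEven d)) m x
ConsB≡Consistent d zero    x = refl
ConsB≡Consistent d (suc m) x
  rewrite hatB≡hat (suc d) m (child false x) | hatB≡hat (suc d) m (child true x)
        | ConsB≡Consistent (suc d) m (child false x) | ConsB≡Consistent (suc d) m (child true x)
  with isEven d
... | true  = refl
... | false = refl

hat-zero : ∀ e m → hat e m (λ _ → 0ℚ) ≡ 0ℚ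
hat-zero e     zero    = refl
hat-zero true  (suc m) rewrite hat-zero false m = refl
hat-zero false (suc m) rewrite hat-zero true m = refl

Consistent-zero : ∀ e m → Consistent e m (λ _ → 0ℚ)
Consistent-zero e     zero    = tt
Consistent-zero true  (suc m) = tt , Consistent-zero false m , Consistent-zero false m
Consistent-zero false (suc m) = refl , Consistent-zero true m , Consistent-zero true m

-- play fA fB e d m p : the remaining m bits after the prefix p of length d, Alice moving next iff e.
play : Strategy → Strategy → Bool → (d m : ℕ) → Vec Bool d → Vec Bool m
play fA fB e d zero    p = []
play fA fB e d (suc m) p =
  let b = if e then fA d p else fB d p in b ∷ play fA fB (not e) (suc d) m (p ∷ʳ b)

run≡play : ∀ fA fB d m p → run fA fB d m p ≡ play fA fB (isEven d) d m p
run≡play fA fB d zero    p = refl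
run≡play fA fB d (suc m) p = cong (_ ∷_) (run≡play fA fB (suc d) m _)

shift : Strategy → Bool → Strategy
shift f b j q = f (suc j) (b ∷ q)

play-shift : ∀ fA fB e d m b p →
  play fA fB e (suc d) m (b ∷ p) ≡ play (shift fA b) (shift fB b) e d m p
play-shift fA fB e d zero    b p = refl
play-shift fA fB e d (suc m) b p = cong (_ ∷_) (play-shift fA fB (not e) (suc d) m b _)

follows : Strategy → Bool → ∀ {m} → Vec Bool m → Bool
follows f e []      = true
follows f e (b ∷ s) = (if e then does (b Bool.≟ f 0 []) else true) ∧ follows (shift f b) (not e) s

accepting : Strategy → Bool → ∀ {m} → Vec Bool m → Bool
accepting f e ℓ = follows f e ℓ ∧ verdict ℓ

hat-follows : ∀ e m f → hat e m (indicator (follows f e)) ≡ 1ℚ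
hat-follows e     zero    f = refl
hat-follows true  (suc m) f with f 0 []
... | false rewrite hat-follows false m (shift f false) | hat-zero false m = refl
... | true  rewrite hat-follows false m (shift f true)  | hat-zero false m = refl
hat-follows false (suc m) f
  rewrite hat-follows true m (shift f false) | hat-follows true m (shift f true) = refl

Consistent-follows : ∀ e m f → Consistent e m (indicator (follows f e))
Consistent-follows e     zero    f = tt
Consistent-follows true  (suc m) f with f 0 []
... | false = tt , Consistent-follows false m (shift f false) , Consistent-zero false m
... | true  = tt , Consistent-zero false m , Consistent-follows false m (shift f true)
Consistent-follows false (suc m) f =
  trans (hat-follows true m (shift f false)) (sym (hat-follows true m (shift f true))) ,
  Consistent-follows true m (shift f false) , Consistent-follows true m (shift f true)

play-follows : ∀ m fA fB e →
  follows fA e (play fA fB e 0 m []) ≡ true × follows fB (not e) (play fA fB e 0 m []) ≡ true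
play-follows zero    fA fB e = refl , refl
play-follows (suc m) fA fB true
  rewrite play-shift fA fB false 0 m (fA 0 []) [] | dec-true (fA 0 [] Bool.≟ fA 0 []) refl
  = play-follows m (shift fA (fA 0 [])) (shift fB (fA 0 [])) false
play-follows (suc m) fA fB false
  rewrite play-shift fA fB true 0 m (fB 0 []) [] | dec-true (fB 0 [] Bool.≟ fB 0 []) refl
  = play-follows m (shift fA (fB 0 [])) (shift fB (fB 0 [])) true

follows⇒play : ∀ m fA fB e (ℓ : Vec Bool m) →
  follows fA e ℓ ≡ true → follows fB (not e) ℓ ≡ true → ℓ ≡ play fA fB e 0 m []
follows⇒play zero    fA fB e [] _ _ = refl
follows⇒play (suc m) fA fB true (b ∷ s) pA pB
  rewrite sym (fromDoes (b Bool.≟ fA 0 []) (∧-conicalˡ _ _ pA)) =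
  cong (b ∷_) (trans (follows⇒play m (shift fA b) (shift fB b) false s (∧-conicalʳ _ _ pA) pB)
                     (sym (play-shift fA fB false 0 m b [])))
follows⇒play (suc m) fA fB false (b ∷ s) pA pB
  rewrite sym (fromDoes (b Bool.≟ fB 0 []) (∧-conicalˡ _ _ pB)) =
  cong (b ∷_) (trans (follows⇒play m (shift fA b) (shift fB b) true s pA (∧-conicalʳ _ _ pB))
                     (sym (play-shift fA fB true 0 m b [])))

transcript-follows : ∀ k fA fB →
  follows fA true (transcript k fA fB) ≡ true × follows fB false (transcript k fA fB) ≡ true
transcript-follows k fA fB rewrite run≡play fA fB 0 k [] = play-follows k fA fB true

follows⇒transcript : ∀ k fA fB (ℓ : Vec Bool k) →
  follows fA true ℓ ≡ true → follows fB false ℓ ≡ true → ℓ ≡ transcript k fA fB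
follows⇒transcript k fA fB ℓ pA pB =
  trans (follows⇒play k fA fB true ℓ pA pB) (sym (run≡play fA fB 0 k []))

⟨accepting⟩≡verdict : ∀ k fA fB →
  ⟨ indicator {k} (accepting fA true) , indicator (accepting fB false) ⟩ ≡
  boolℚ (verdict (transcript k fA fB))
⟨accepting⟩≡verdict k fA fB =
  trans (⟨indicator⟩-single (accepting fA true) (accepting fB false) t common)
        (cong boolℚ both)
  where
  t = transcript k fA fB
  common : ∀ ℓ → accepting fA true ℓ ∧ accepting fB false ℓ ≡ true → ℓ ≡ t
  common ℓ p = follows⇒transcript k fA fB ℓ (∧-conicalˡ _ (verdict ℓ) (∧-conicalˡ _ _ p))
                                            (∧-conicalˡ _ (verdict ℓ) (∧-conicalʳ (accepting fA true ℓ) _ p))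
  both : accepting fA true t ∧ accepting fB false t ≡ verdict t
  both rewrite proj₁ (transcript-follows k fA fB) | proj₂ (transcript-follows k fA fB) = ∧-idem _

isOne : ℚ → Bool
isOne q = does (q ≟ 1ℚ)

hasOne : ∀ {m} → Vect m → Bool
hasOne {zero}  x = isOne (x [])
hasOne {suc m} x = hasOne (child false x) ∨ hasOne (child true x)

hasOne-intro : ∀ {m} (x : Vect m) ℓ → x ℓ ≡ 1ℚ → hasOne x ≡ true
hasOne-intro x []          p = dec-true (x [] ≟ 1ℚ) p
hasOne-intro x (false ∷ ℓ) p rewrite hasOne-intro (child false x) ℓ p = refl
hasOne-intro x (true ∷ ℓ)  p rewrite hasOne-intro (child true x) ℓ p = ∨-zeroʳ _

hasOne-elim : ∀ {m} (x : Vect m) → hasOne x ≡ true → Σ (Vec Bool m) λ ℓ → x ℓ ≡ 1ℚ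
hasOne-elim {zero}  x h = [] , fromDoes (x [] ≟ 1ℚ) h
hasOne-elim {suc m} x h with hasOne (child false x) in h₀
... | true  = let (s , p) = hasOne-elim (child false x) h₀ in false ∷ s , p
... | false = let (s , p) = hasOne-elim (child true x) h  in true ∷ s , p

strategyOf : ∀ {k} → Vect k → Strategy
strategyOf {zero}  x j       p       = false
strategyOf {suc k} x zero    []      = hasOne (child true x)
strategyOf {suc k} x (suc j) (b ∷ p) = strategyOf (child b x) j p

-- hat ≤ 1 rather than = 1: this is the part of membership in K̃ that passes to every subtree.
record Feasible (e : Bool) (m : ℕ) (y : Vect m) : Set where
  field
    nonneg     : ∀ ℓ → 0ℚ ≤ y ℓ
    consistent : Consistent e m y
    hat≤1      : hat e m y ≤ 1ℚ
open Feasible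

half-double : ∀ a → ½ * (a + a) ≡ a
half-double a = begin
  ½ * (a + a)     ≡⟨ ℚ.*-distribˡ-+ ½ a a ⟩
  ½ * a + ½ * a   ≡⟨ ℚ.*-distribʳ-+ a ½ ½ ⟨
  (½ + ½) * a     ≡⟨ ℚ.*-identityˡ a ⟩
  a               ∎
  where open ≡-Reasoning

p≤p+q : ∀ p {q} → 0ℚ ≤ q → p ≤ p + q
p≤p+q p 0≤q = subst (_≤ p + _) (ℚ.+-identityʳ p) (ℚ.+-monoʳ-≤ p 0≤q)

q≤p+q : ∀ {p} q → 0ℚ ≤ p → q ≤ p + q
q≤p+q {p} q 0≤p = subst (_≤ p + q) (ℚ.+-identityˡ q) (ℚ.+-monoˡ-≤ q 0≤p)

hat-nonneg : ∀ e m (y : Vect m) → (∀ ℓ → 0ℚ ≤ y ℓ) → 0ℚ ≤ hat e m y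
hat-nonneg e zero y nn = nn []
hat-nonneg true (suc m) y nn =
  ℚ.+-mono-≤ (hat-nonneg false m _ (nn ∘ (false ∷_))) (hat-nonneg false m _ (nn ∘ (true ∷_)))
hat-nonneg false (suc m) y nn =
  ℚ.*-monoˡ-≤-nonNeg ½ (ℚ.+-mono-≤ (hat-nonneg true m _ (nn ∘ (false ∷_)))
                                   (hat-nonneg true m _ (nn ∘ (true ∷_))))

hat-child≡ : ∀ m (y : Vect (suc m)) → Consistent false (suc m) y →
  ∀ c → hat true m (child c y) ≡ hat false (suc m) y
hat-child≡ m y (eq , _) false =
  sym (trans (cong (λ h → ½ * (hat true m (child false y) + h)) (sym eq)) (half-double _))
hat-child≡ m y (eq , _) true =
  sym (trans (cong (λ h → ½ * (h + hat true m (child true y))) eq) (half-double _))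

hat-child≤ : ∀ e m (y : Vect (suc m)) → (∀ ℓ → 0ℚ ≤ y ℓ) → Consistent e (suc m) y →
  ∀ c → hat (not e) m (child c y) ≤ hat e (suc m) y
hat-child≤ true  m y nn _ false = p≤p+q _ (hat-nonneg false m _ (nn ∘ (true ∷_)))
hat-child≤ true  m y nn _ true  = q≤p+q _ (hat-nonneg false m _ (nn ∘ (false ∷_)))
hat-child≤ false m y nn c b     = ℚ.≤-reflexive (hat-child≡ m y c b)

Consistent-child : ∀ e m (y : Vect (suc m)) → Consistent e (suc m) y →
  ∀ c → Consistent (not e) m (child c y)
Consistent-child e m y (_ , c₀ , _)  false = c₀
Consistent-child e m y (_ , _  , c₁) true  = c₁

Feasible-child : ∀ {e m} {y : Vect (suc m)} → Feasible e (suc m) y → ∀ c → Feasible (not e) m (child c y)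
Feasible-child {e} {m} {y} F c = record
  { nonneg     = nonneg F ∘ (c ∷_)
  ; consistent = Consistent-child e m y (consistent F) c
  ; hat≤1      = ℚ.≤-trans (hat-child≤ e m y (nonneg F) (consistent F) c) (hat≤1 F)
  }

leaf≤hat : ∀ e m (y : Vect m) → (∀ ℓ → 0ℚ ≤ y ℓ) → Consistent e m y → ∀ ℓ → y ℓ ≤ hat e m y
leaf≤hat e zero y nn c [] = ℚ.≤-refl
leaf≤hat e (suc m) y nn c (b ∷ s) =
  ℚ.≤-trans (leaf≤hat (not e) m (child b y) (nn ∘ (b ∷_)) (Consistent-child e m y c b) s)
            (hat-child≤ e m y nn c b)

one≤hat : ∀ {e m} {y : Vect m} → Feasible e m y → ∀ ℓ → y ℓ ≡ 1ℚ → 1ℚ ≤ hat e m y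
one≤hat {e} {m} {y} F ℓ p = subst (_≤ hat e m y) p (leaf≤hat e m y (nonneg F) (consistent F) ℓ)

exclusive-moves : ∀ {m} {y : Vect (suc m)} → Feasible true (suc m) y →
  ∀ s s′ → y (false ∷ s) ≡ 1ℚ → y (true ∷ s′) ≡ 1ℚ → ⊥
exclusive-moves F s s′ p q =
  from-no (1ℚ + 1ℚ ≤? 1ℚ)
    (ℚ.≤-trans (ℚ.+-mono-≤ (one≤hat (Feasible-child F false) s p) (one≤hat (Feasible-child F true) s′ q))
               (hat≤1 F))

_≐_∗v : ∀ {k} → Vect k → Vect k → Set
x ≐ y ∗v = ∀ ℓ → x ℓ ≡ y ℓ * vVec ℓ

≐∗v-child : ∀ {m} (x y : Vect (suc (suc m))) → x ≐ y ∗v → ∀ c → child c x ≐ child c y ∗v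
≐∗v-child x y x≐ c (d ∷ r) = x≐ (c ∷ d ∷ r)

≐∗v-one : ∀ {k} (x y : Vect k) → x ≐ y ∗v → ∀ ℓ → x ℓ ≡ 1ℚ → y ℓ ≡ 1ℚ × verdict ℓ ≡ true
≐∗v-one x y x≐ ℓ p with verdict ℓ | x≐ ℓ
... | true  | e = trans (sym (ℚ.*-identityʳ (y ℓ))) (trans (sym e) p) , refl
... | false | e = ⊥-elim (ℚ.1≢0 (trans (sym p) (trans e (ℚ.*-zeroʳ (y ℓ)))))

strategyOf-picks : ∀ {m} {x y : Vect (suc m)} → Feasible true (suc m) y →
  (∀ ℓ → x ℓ ≡ 1ℚ → y ℓ ≡ 1ℚ) → ∀ b s → x (b ∷ s) ≡ 1ℚ → hasOne (child true x) ≡ b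
strategyOf-picks {x = x} F ones true  s p = hasOne-intro (child true x) s p
strategyOf-picks {x = x} F ones false s p with hasOne (child true x) in h
... | false = refl
... | true  = let (s′ , q) = hasOne-elim (child true x) h in
  ⊥-elim (exclusive-moves F s s′ (ones _ p) (ones _ q))

one⇒follows : ∀ e m (x y : Vect m) → Feasible e m y → (∀ ℓ → x ℓ ≡ 1ℚ → y ℓ ≡ 1ℚ) →
  ∀ ℓ → x ℓ ≡ 1ℚ → follows (strategyOf x) e ℓ ≡ true
one⇒follows e zero x y F ones [] p = refl
one⇒follows true (suc m) x y F ones (b ∷ s) p
  rewrite strategyOf-picks F ones b s p | dec-true (b Bool.≟ b) refl =
  one⇒follows false m (child b x) (child b y) (Feasible-child F b) (ones ∘ (b ∷_)) s p
one⇒follows false (suc m) x y F ones (b ∷ s) p =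
  one⇒follows true m (child b x) (child b y) (Feasible-child F b) (ones ∘ (b ∷_)) s p

one⇒accepting : ∀ e m (x y : Vect m) → Feasible e m y → x ≐ y ∗v →
  ∀ ℓ → x ℓ ≡ 1ℚ → accepting (strategyOf x) e ℓ ≡ true
one⇒accepting e m x y F x≐ ℓ p
  rewrite one⇒follows e m x y F (λ ℓ′ → proj₁ ∘ ≐∗v-one x y x≐ ℓ′) ℓ p = proj₂ (≐∗v-one x y x≐ ℓ p)

-- whether the player who moves next iff e makes the last of m + 1 remaining moves
lastMover : Bool → ℕ → Bool
lastMover e zero    = e
lastMover e (suc m) = lastMover (not e) m

lastMover-accepting⇒one : ∀ e m (x : Vect (suc m)) ℓ → lastMover e m ≡ true →
  follows (strategyOf x) e ℓ ≡ true → verdict ℓ ≡ true → x ℓ ≡ 1ℚ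
lastMover-accepting⇒one true zero x (true ∷ []) _ f refl =
  fromDoes (x (true ∷ []) ≟ 1ℚ) (sym (fromDoes (true Bool.≟ _) (∧-conicalˡ _ true f)))
lastMover-accepting⇒one e (suc m) x (b ∷ c ∷ r) last f v =
  lastMover-accepting⇒one (not e) m (child b x) (c ∷ r) last (∧-conicalʳ (if e then _ else true) _ f) v

-- When Bob moves last, a subtree of Alice's without a 1 of x carries no weight: at Bob's last
-- moves y agrees on both leaves, and on the accepting one it agrees with x.
noOne⇒hat≡0 : ∀ e m (x y : Vect (suc m)) → Consistent e (suc m) y → x ≐ y ∗v → Binary x →
  lastMover e m ≡ false → hasOne x ≡ false → hat e (suc m) y ≡ 0ℚ
noOne⇒hat≡0 false zero x y (y₀≡y₁ , _) x≐ bin _ none =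
  cong₂ (λ a b → ½ * (a + b)) (trans y₀≡y₁ y₁≡0) y₁≡0
  where
  x₁≡0 : x (true ∷ []) ≡ 0ℚ
  x₁≡0 with bin (true ∷ [])
  ... | inj₁ p = p
  ... | inj₂ p with () ← trans (sym (dec-true (x (true ∷ []) ≟ 1ℚ) p)) (∨-conicalʳ _ _ none)
  y₁≡0 : y (true ∷ []) ≡ 0ℚ
  y₁≡0 = trans (sym (ℚ.*-identityʳ _)) (trans (sym (x≐ (true ∷ []))) x₁≡0)
noOne⇒hat≡0 true (suc m) x y c x≐ bin last none =
  cong₂ _+_ (noOne⇒hat≡0 false m (child false x) (child false y) (Consistent-child true _ y c false)
                         (≐∗v-child x y x≐ false) (bin ∘ (false ∷_)) last (∨-conicalˡ (hasOne (child false x)) _ none))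
            (noOne⇒hat≡0 false m (child true x) (child true y) (Consistent-child true _ y c true)
                         (≐∗v-child x y x≐ true) (bin ∘ (true ∷_)) last (∨-conicalʳ (hasOne (child false x)) _ none))
noOne⇒hat≡0 false (suc m) x y c x≐ bin last none =
  trans (sym (hat-child≡ (suc m) y c false))
        (noOne⇒hat≡0 true m (child false x) (child false y) (Consistent-child false _ y c false)
                     (≐∗v-child x y x≐ false) (bin ∘ (false ∷_)) last (∨-conicalˡ (hasOne (child false x)) _ none))

chosen-hat≡1 : ∀ m (x y : Vect (suc (suc m))) → Feasible true (suc (suc m)) y → hat true _ y ≡ 1ℚ →
  x ≐ y ∗v → Binary x → lastMover false m ≡ false →
  hat false (suc m) (child (hasOne (child true x)) y) ≡ 1ℚ
chosen-hat≡1 m x y F h≡1 x≐ bin last with hasOne (child true x) in h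
... | true =
  let (s , p) = hasOne-elim (child true x) h
      F₁ = Feasible-child F true
  in ℚ.≤-antisym (hat≤1 F₁) (one≤hat F₁ s (proj₁ (≐∗v-one x y x≐ (true ∷ s) p)))
... | false = begin
  hat false (suc m) (child false y)       ≡⟨ ℚ.+-identityʳ _ ⟨
  hat false (suc m) (child false y) + 0ℚ  ≡⟨ cong (hat false (suc m) (child false y) +_) right≡0 ⟨
  hat true (suc (suc m)) y                ≡⟨ h≡1 ⟩
  1ℚ                                      ∎
  where
  open ≡-Reasoning
  right≡0 : hat false (suc m) (child true y) ≡ 0ℚ
  right≡0 = noOne⇒hat≡0 false m (child true x) (child true y)
              (Consistent-child true _ y (consistent F) true) (≐∗v-child x y x≐ true) (bin ∘ (true ∷_)) last h

-- Along a path followed by strategyOf x the weight hat = 1 is preserved, down to Bob's last move.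
opponentLast-accepting⇒one : ∀ e m (x y : Vect (suc m)) → Feasible e (suc m) y → hat e (suc m) y ≡ 1ℚ →
  x ≐ y ∗v → Binary x → lastMover e m ≡ false →
  ∀ ℓ → follows (strategyOf x) e ℓ ≡ true → verdict ℓ ≡ true → x ℓ ≡ 1ℚ
opponentLast-accepting⇒one false zero x y F h≡1 x≐ bin _ (true ∷ []) _ refl =
  trans (x≐ (true ∷ [])) (trans (ℚ.*-identityʳ _) (trans (hat-child≡ 0 y (consistent F) true) h≡1))
opponentLast-accepting⇒one true (suc m) x y F h≡1 x≐ bin last (b ∷ c ∷ r) f v =
  opponentLast-accepting⇒one false m (child b x) (child b y) (Feasible-child F b) chosen
    (≐∗v-child x y x≐ b) (bin ∘ (b ∷_)) last (c ∷ r) (∧-conicalʳ (does (b Bool.≟ _)) _ f) v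
  where
  chosen : hat false (suc m) (child b y) ≡ 1ℚ
  chosen rewrite fromDoes (b Bool.≟ _) (∧-conicalˡ _ _ f) = chosen-hat≡1 m x y F h≡1 x≐ bin last
opponentLast-accepting⇒one false (suc m) x y F h≡1 x≐ bin last (b ∷ c ∷ r) f v =
  opponentLast-accepting⇒one true m (child b x) (child b y) (Feasible-child F b)
    (trans (hat-child≡ (suc m) y (consistent F) b) h≡1) (≐∗v-child x y x≐ b) (bin ∘ (b ∷_)) last (c ∷ r) f v

accepting⇒one : ∀ e m (x y : Vect (suc m)) → Feasible e (suc m) y → hat e (suc m) y ≡ 1ℚ →
  x ≐ y ∗v → Binary x → ∀ ℓ → accepting (strategyOf x) e ℓ ≡ true → x ℓ ≡ 1ℚ
accepting⇒one e m x y F h≡1 x≐ bin ℓ acc with lastMover e m in last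
... | true  = lastMover-accepting⇒one e m x ℓ last f v
  where f = ∧-conicalˡ _ (verdict ℓ) acc
        v = ∧-conicalʳ (follows (strategyOf x) e ℓ) _ acc
... | false = opponentLast-accepting⇒one e m x y F h≡1 x≐ bin last ℓ f v
  where f = ∧-conicalˡ _ (verdict ℓ) acc
        v = ∧-conicalʳ (follows (strategyOf x) e ℓ) _ acc

≡indicator-accepting : ∀ e m (x y : Vect (suc m)) → Feasible e (suc m) y → hat e (suc m) y ≡ 1ℚ →
  x ≐ y ∗v → Binary x → ∀ ℓ → x ℓ ≡ indicator (accepting (strategyOf x) e) ℓ
≡indicator-accepting e m x y F h≡1 x≐ bin ℓ with bin ℓ | accepting (strategyOf x) e ℓ in acc
... | inj₁ x≡0 | false = x≡0
... | inj₂ x≡1 | true  = x≡1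
... | inj₁ x≡0 | true  = ⊥-elim (ℚ.1≢0 (trans (sym (accepting⇒one e m x y F h≡1 x≐ bin ℓ acc)) x≡0))
... | inj₂ x≡1 | false with () ← trans (sym (one⇒accepting e (suc m) x y F x≐ ℓ x≡1)) acc

indicator-∗v : ∀ {k} (a : Vec Bool k → Bool) → indicator (λ ℓ → a ℓ ∧ verdict ℓ) ≐ indicator a ∗v
indicator-∗v a ℓ = sym (boolℚ-* (a ℓ) (verdict ℓ))

S̃A-follows : ∀ k f → S̃A k (indicator (follows f true))
S̃A-follows k f =
  ( indicator-unitCube (follows f true)
  , trans (hatA≡hat 0 k _) (hat-follows true k f)
  , subst id (sym (ConsA≡Consistent 0 k _)) (Consistent-follows true k f) )
  , indicator-binary (follows f true)

S̃B-follows : ∀ k f → S̃B k (indicator (follows f false))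
S̃B-follows k f =
  ( indicator-unitCube (follows f false)
  , trans (hatB≡hat 0 k _) (hat-follows false k f)
  , subst id (sym (ConsB≡Consistent 0 k _)) (Consistent-follows false k f) )
  , indicator-binary (follows f false)

SA-accepting : ∀ k f → SA k (indicator (accepting f true))
SA-accepting k f = (_ , proj₁ (S̃A-follows k f) , indicator-∗v (follows f true)) , indicator-binary (accepting f true)

SB-accepting : ∀ k f → SB k (indicator (accepting f false))
SB-accepting k f = (_ , proj₁ (S̃B-follows k f) , indicator-∗v (follows f false)) , indicator-binary (accepting f false)

SA⇒indicator-accepting : ∀ m {x} → SA (suc m) x → ∀ ℓ → x ℓ ≡ indicator (accepting (strategyOf x) true) ℓ
SA⇒indicator-accepting m {x} ((y , (cube , h≡1 , c) , x≐) , bin) =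
  ≡indicator-accepting true m x y F (trans (sym (hatA≡hat 0 _ y)) h≡1) x≐ bin
  where
  F : Feasible true (suc m) y
  F = record { nonneg     = proj₁ ∘ cube
             ; consistent = subst id (ConsA≡Consistent 0 _ y) c
             ; hat≤1      = ℚ.≤-reflexive (trans (sym (hatA≡hat 0 _ y)) h≡1) }

SB⇒indicator-accepting : ∀ m {x} → SB (suc m) x → ∀ ℓ → x ℓ ≡ indicator (accepting (strategyOf x) false) ℓ
SB⇒indicator-accepting m {x} ((y , (cube , h≡1 , c) , x≐) , bin) =
  ≡indicator-accepting false m x y F (trans (sym (hatB≡hat 0 _ y)) h≡1) x≐ bin
  where
  F : Feasible false (suc m) y
  F = record { nonneg     = proj₁ ∘ cube
             ; consistent = subst id (ConsB≡Consistent 0 _ y) c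
             ; hat≤1      = ℚ.≤-reflexive (trans (sym (hatB≡hat 0 _ y)) h≡1) }

proposition5p2 : (k : ℕ) → 0 < k →
    (Σ (Strategy → Vect k) λ tA → Σ (Strategy → Vect k) λ xA →
     Σ (Strategy → Vect k) λ tB → Σ (Strategy → Vect k) λ xB →
       (∀ fA → S̃A k (tA fA) × SA k (xA fA))
     × (∀ fB → S̃B k (tB fB) × SB k (xB fB))
     × (∀ fA fB →
          (tA fA (transcript k fA fB) ≡ 1ℚ
           × tB fB (transcript k fA fB) ≡ 1ℚ
           × (∀ ℓ → tA fA ℓ ≡ 1ℚ → tB fB ℓ ≡ 1ℚ → ℓ ≡ transcript k fA fB))
        × (verdict (transcript k fA fB) ≡ true → ⟨ xA fA , xB fB ⟩ ≡ 1ℚ)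
        × (verdict (transcript k fA fB) ≡ false → ⟨ xA fA , xB fB ⟩ ≡ 0ℚ)))
    ×
    (Σ ((x : Vect k) → SA k x → Strategy) λ gA →
     Σ ((x : Vect k) → SB k x → Strategy) λ gB →
       ∀ xA (hA : SA k xA) xB (hB : SB k xB) →
         (verdict (transcript k (gA xA hA) (gB xB hB)) ≡ true) ⇔ (⟨ xA , xB ⟩ ≡ 1ℚ))
proposition5p2 k@(suc m) _ =
  ( (λ f → indicator (follows f true))  , (λ f → indicator (accepting f true))
  , (λ f → indicator (follows f false)) , (λ f → indicator (accepting f false))
  , (λ f → S̃A-follows k f , SA-accepting k f)
  , (λ f → S̃B-follows k f , SB-accepting k f)
  , λ fA fB →
      let (tA , tB) = transcript-follows k fA fB
          inner = ⟨accepting⟩≡verdict k fA fB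
      in ( cong boolℚ tA , cong boolℚ tB
         , λ ℓ pA pB → follows⇒transcript k fA fB ℓ (boolℚ≡1⇒true pA) (boolℚ≡1⇒true pB) )
         , (λ v → trans inner (cong boolℚ v))
         , (λ v → trans inner (cong boolℚ v)) )
  , (λ x _ → strategyOf x) , (λ x _ → strategyOf x)
  , λ xA hA xB hB →
      let inner = trans (⟨⟩-cong (SA⇒indicator-accepting m hA) (SB⇒indicator-accepting m hB))
                        (⟨accepting⟩≡verdict k (strategyOf xA) (strategyOf xB))
      in mk⇔ (λ v → trans inner (cong boolℚ v)) (λ p → boolℚ≡1⇒true (trans (sym inner) p))
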